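{- For every integer $n\ge 3$, $k(H(n,3)) \le (n-3)3^{n-1}+6$.
   Context: The Hamming graph $H(n,3)$ has vertex set $\{1,2,3\}^n$, two vertices being adjacent iff they differ in exactly one coordinate. The competition graph $C(D)$ of a digraph $D$ is the simple graph on $V(D)$ in which distinct $u,v$ are adjacent iff some vertex $x$ satisfies $(u,x),(v,x)\in A(D)$. The competition number $k(G)$ of a graph $G$ is the least $k\ge0$ such that $G$ together with $k$ new isolated vertices is the competition graph of an acyclic digraph. -}

module Defs where

open import Data.Nat using (ℕ; _≤_)
open import Data.Fin using (Fin)
open import Data.Vec using (Vec; lookup)
open import Data.Sum using (_⊎_; inj₁; inj₂)
open import Data.Product using (_×_; ∃; ∃-syntax)
open import Data.Empty using (⊥)
open import Relation.Nullary using (¬_)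
open import Relation.Binary.PropositionalEquality using (_≡_; _≢_)
open import Relation.Binary.Construct.Closure.Transitive using (TransClosure)
open import Function.Bundles using (_⇔_)

Graph : Set → Set₁
Graph V = V → V → Set

Digraph : Set → Set₁
Digraph W = W → W → Set

Acyclic : {W : Set} → Digraph W → Set
Acyclic {W} D = (x : W) → ¬ TransClosure D x x

IsCompetitionGraphOf : {W : Set} → Graph W → Digraph W → Set
IsCompetitionGraphOf {W} G D =
  (u v : W) → u ≢ v → G u v ⇔ (∃[ x ] (D u x × D v x))

WithIsolated : {V : Set} → Graph V → (k : ℕ) → Graph (V ⊎ Fin k)
WithIsolated G k (inj₁ u) (inj₁ v) = G u v
WithIsolated G k (inj₁ u) (inj₂ _) = ⊥
WithIsolated G k (inj₂ _) _        = ⊥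

CompetitionRepresentable : {V : Set} → Graph V → ℕ → Set₁
CompetitionRepresentable {V} G k =
  ∃[ D ] (Acyclic {V ⊎ Fin k} D × IsCompetitionGraphOf (WithIsolated G k) D)

-- k(G) ≤ b : the least k with G ∪ I_k representable is at most b,
-- i.e. some k ≤ b works.
CompetitionNumber≤ : {V : Set} → Graph V → ℕ → Set₁
CompetitionNumber≤ G b = ∃[ k ] (k ≤ b × CompetitionRepresentable G k)

Hamming3 : (n : ℕ) → Graph (Vec (Fin 3) n)
Hamming3 n a b =
  ∃[ i ] (lookup a i ≢ lookup b i ×
          ((j : Fin n) → j ≢ i → lookup a j ≡ lookup b j))

module Submission where

open import Defs
open import Data.Nat using (ℕ; zero; suc; _≤_; _<_; _<?_; s≤s; _+_; _*_; _∸_; _^_)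
open import Data.Nat.Properties
  using (≤-refl; <-irrefl; <-trans; +-monoˡ-<; *-suc; m≤n+m; module ≤-Reasoning)
open import Data.Fin using (Fin; zero; suc; #_; toℕ; combine; _↑ˡ_; _↑ʳ_; punchOut)
open import Data.Fin.Properties using (all?; suc-injective; combine-injective; ↑ˡ-injective; ↑ʳ-injective)
  renaming (_≟_ to _≟ᶠ_)
open import Data.Vec using (Vec; []; _∷_; lookup; removeAt; insertAt; replicate; _++_)
open import Data.Vec.Properties
  using (tabulate∘lookup; tabulate-cong; removeAt-punchOut; insertAt-removeAt; ++-injective)
  renaming (≡-dec to ≡-decᵛ)
open import Data.Sum using (_⊎_; inj₁; inj₂)
open import Data.Sum.Properties using (inj₁-injective; inj₂-injective) renaming (≡-dec to ≡-decˢ)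
open import Data.Product using (_×_; _,_; proj₁; proj₂; ∃-syntax)
open import Data.Product.Properties using () renaming (≡-dec to ≡-decᵖ)
open import Data.Maybe using (Maybe; just; nothing) renaming (map to mapᴹ)
open import Data.Maybe.Properties using (just-injective)
open import Data.Empty using (⊥; ⊥-elim)
open import Data.Unit using (⊤)
open import Function using (_∘_)
open import Function.Bundles using (_⇔_; mk⇔; Equivalence)
open import Function.Definitions using (Injective)
open import Relation.Nullary using (Dec; yes; map′; ¬?)
open import Relation.Nullary.Decidable using (from-yes; _→-dec_)
open import Relation.Binary using (DecidableEquality)
open import Relation.Binary.PropositionalEquality
  using (_≡_; _≢_; refl; sym; trans; cong; cong₂; subst; module ≡-Reasoning)
open import Relation.Binary.Construct.Closure.Transitive using (TransClosure; [_]; _∷_)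

-- Every edge of H(n,3) lies in exactly one line, a triangle obtained by varying one
-- coordinate. If every line gets its own prey, eaten by the three vertices of the line,
-- the competition graph is H(n,3) plus isolated vertices, and it remains to make the
-- digraph acyclic while spending few isolated vertices. Lines varying one of the last
-- n − 3 coordinates get (n − 3)·3^(n−1) fresh isolated vertices. Lines varying one of
-- the first three coordinates lie in a cube {1,2,3}³ × {t} determined by their tail t.
-- Inside each cube, 21 of the 27 lines get a vertex of the same cube as prey, ranked
-- above the line's vertices in a fixed order of the cube (essentially a representation
-- of H(3,3) with six extra vertices); the other six lines get the six unused vertices of
-- the next cube in base-3 order of tails, or six final isolated vertices after the last
-- cube. Ordering vertices by tail first makes every arc point upward.

module CliqueCoverRepresentation
  {V L : Set} {G : Graph V} {k : ℕ}
  (_∈_ : V → L → Set)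
  (covers : ∀ u v → u ≢ v → G u v ⇔ (∃[ ℓ ] (u ∈ ℓ × v ∈ ℓ)))
  (prey : L → V ⊎ Fin k) (prey-injective : Injective _≡_ _≡_ prey)
  (rank : V → ℕ) (rank-<-prey : ∀ u ℓ {v} → u ∈ ℓ → prey ℓ ≡ inj₁ v → rank u < rank v)
  where

  Preys : Digraph (V ⊎ Fin k)
  Preys (inj₁ u) x = ∃[ ℓ ] (u ∈ ℓ × prey ℓ ≡ x)
  Preys (inj₂ _) _ = ⊥

  path-rank : ∀ {u v} → TransClosure Preys (inj₁ u) (inj₁ v) → rank u < rank v
  path-rank {u} [ ℓ , u∈ℓ , eq ] = rank-<-prey u ℓ u∈ℓ eq
  path-rank {u} (_∷_ {y = inj₁ _} (ℓ , u∈ℓ , eq) path) =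
    <-trans (rank-<-prey u ℓ u∈ℓ eq) (path-rank path)
  path-rank (_∷_ {y = inj₂ _} _ [ () ])
  path-rank (_∷_ {y = inj₂ _} _ (() ∷ _))

  acyclic : Acyclic Preys
  acyclic (inj₁ _) cycle = <-irrefl refl (path-rank cycle)
  acyclic (inj₂ _) [ () ]
  acyclic (inj₂ _) (() ∷ _)

  competition : IsCompetitionGraphOf (WithIsolated G k) Preys
  competition (inj₁ u) (inj₁ v) u≢v = mk⇔ common-prey shared-line
    where
    open Equivalence (covers u v (u≢v ∘ cong inj₁))

    common-prey : G u v → ∃[ x ] (Preys (inj₁ u) x × Preys (inj₁ v) x)
    common-prey adjacent with to adjacent
    ... | ℓ , u∈ℓ , v∈ℓ = prey ℓ , (ℓ , u∈ℓ , refl) , (ℓ , v∈ℓ , refl)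

    shared-line : ∃[ x ] (Preys (inj₁ u) x × Preys (inj₁ v) x) → G u v
    shared-line (_ , (ℓ , u∈ℓ , eq) , (ℓ′ , v∈ℓ′ , eq′)) =
      from (ℓ , u∈ℓ , subst (v ∈_) (prey-injective (trans eq′ (sym eq))) v∈ℓ′)
  competition (inj₁ _) (inj₂ _) _ = mk⇔ ⊥-elim λ { (_ , _ , ()) }
  competition (inj₂ _) _        _ = mk⇔ ⊥-elim λ { (_ , () , _) }

  representable : CompetitionRepresentable G k
  representable = Preys , acyclic , competition

Line : Set → ℕ → Set
Line A n = Fin (suc n) × Vec A n

_∈ᴸ_ : ∀ {A : Set} {n} → Vec A (suc n) → Line A n → Set
u ∈ᴸ (i , w) = removeAt u i ≡ w

AgreeOutside : ∀ {A : Set} {n} → Vec A n → Vec A n → Fin n → Set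
AgreeOutside u v i = ∀ j → j ≢ i → lookup u j ≡ lookup v j

lookup-≗⇒≡ : ∀ {A : Set} {n} {u v : Vec A n} → (∀ j → lookup u j ≡ lookup v j) → u ≡ v
lookup-≗⇒≡ {u = u} {v} eq =
  trans (sym (tabulate∘lookup u)) (trans (tabulate-cong eq) (tabulate∘lookup v))

agreeOutside⇒removeAt≡ : ∀ {A : Set} {n} (u v : Vec A (suc n)) i →
  AgreeOutside u v i → removeAt u i ≡ removeAt v i
agreeOutside⇒removeAt≡ (_ ∷ u) (_ ∷ v) zero agree = lookup-≗⇒≡ λ j → agree (suc j) λ ()
agreeOutside⇒removeAt≡ (_ ∷ u@(_ ∷ _)) (_ ∷ v@(_ ∷ _)) (suc i) agree =
  cong₂ _∷_ (agree zero λ ())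
            (agreeOutside⇒removeAt≡ u v i λ j j≢i → agree (suc j) (j≢i ∘ suc-injective))

removeAt≡⇒agreeOutside : ∀ {A : Set} {n} (u v : Vec A (suc n)) i →
  removeAt u i ≡ removeAt v i → AgreeOutside u v i
removeAt≡⇒agreeOutside u v i eq j j≢i = begin
  lookup u j                                 ≡⟨ sym (removeAt-punchOut u i≢j) ⟩
  lookup (removeAt u i) (punchOut i≢j)       ≡⟨ cong (λ w → lookup w (punchOut i≢j)) eq ⟩
  lookup (removeAt v i) (punchOut i≢j)       ≡⟨ removeAt-punchOut v i≢j ⟩
  lookup v j                                 ∎
  where
  open ≡-Reasoning
  i≢j : i ≢ j
  i≢j = j≢i ∘ sym

removeAt≡∧lookup≡⇒≡ : ∀ {A : Set} {n} (u v : Vec A (suc n)) i →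
  removeAt u i ≡ removeAt v i → lookup u i ≡ lookup v i → u ≡ v
removeAt≡∧lookup≡⇒≡ u v i eq eqᵢ = begin
  u                                          ≡⟨ sym (insertAt-removeAt u i) ⟩
  insertAt (removeAt u i) i (lookup u i)     ≡⟨ cong₂ (λ w x → insertAt w i x) eq eqᵢ ⟩
  insertAt (removeAt v i) i (lookup v i)     ≡⟨ insertAt-removeAt v i ⟩
  v                                          ∎
  where open ≡-Reasoning

hamming3⇔collinear : ∀ {n} (u v : Vec (Fin 3) (suc n)) → u ≢ v →
  Hamming3 (suc n) u v ⇔ (∃[ ℓ ] (u ∈ᴸ ℓ × v ∈ᴸ ℓ))
hamming3⇔collinear u v u≢v = mk⇔ line-through shared-line
  where
  line-through : Hamming3 _ u v → ∃[ ℓ ] (u ∈ᴸ ℓ × v ∈ᴸ ℓ)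
  line-through (i , _ , agree) =
    (i , removeAt u i) , refl , sym (agreeOutside⇒removeAt≡ u v i agree)

  shared-line : ∃[ ℓ ] (u ∈ᴸ ℓ × v ∈ᴸ ℓ) → Hamming3 _ u v
  shared-line ((i , _) , u∈ℓ , v∈ℓ) =
    i , u≢v ∘ removeAt≡∧lookup≡⇒≡ u v i same , removeAt≡⇒agreeOutside u v i same
    where
    same : removeAt u i ≡ removeAt v i
    same = trans u∈ℓ (sym v∈ℓ)

∀-vec? : ∀ {q n} {P : Vec (Fin q) n → Set} → (∀ v → Dec (P v)) → Dec (∀ v → P v)
∀-vec? {n = zero}  P? = map′ (λ { p [] → p }) (λ p → p []) (P? [])
∀-vec? {n = suc n} P? =
  map′ (λ { p (x ∷ v) → p x v }) (λ p x v → p (x ∷ v)) (all? λ x → ∀-vec? λ v → P? (x ∷ v))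

∀-line? : ∀ {q n} {P : Line (Fin q) n → Set} → (∀ ℓ → Dec (P ℓ)) → Dec (∀ ℓ → P ℓ)
∀-line? P? =
  map′ (λ { p (i , w) → p i w }) (λ p i w → p (i , w)) (all? λ i → ∀-vec? λ w → P? (i , w))

encode : ∀ {q n} → Vec (Fin q) n → Fin (q ^ n)
encode []      = zero
encode (x ∷ v) = combine x (encode v)

encode-injective : ∀ {q n} → Injective _≡_ _≡_ (encode {q} {n})
encode-injective {x = []}    {[]}    _  = refl
encode-injective {x = x ∷ v} {y ∷ w} eq with combine-injective x (encode v) y (encode w) eq
... | refl , eq′ = cong (x ∷_) (encode-injective eq′)

-- Least significant digit first.
base3 : ∀ {m} → Vec (Fin 3) m → ℕ
base3 []      = 0
base3 (x ∷ t) = toℕ x + 3 * base3 t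

next : ∀ {m} → Vec (Fin 3) m → Maybe (Vec (Fin 3) m)
next []                    = nothing
next (zero ∷ t)            = just (suc zero ∷ t)
next (suc zero ∷ t)        = just (suc (suc zero) ∷ t)
next (suc (suc zero) ∷ t)  = mapᴹ (zero ∷_) (next t)

previous : ∀ {m} → Vec (Fin 3) m → Maybe (Vec (Fin 3) m)
previous []                   = nothing
previous (zero ∷ t)           = mapᴹ (suc (suc zero) ∷_) (previous t)
previous (suc zero ∷ t)       = just (zero ∷ t)
previous (suc (suc zero) ∷ t) = just (suc zero ∷ t)

next-previous : ∀ {m} {t s : Vec (Fin 3) m} → next t ≡ just s → previous s ≡ just t
next-previous {t = zero ∷ _}          refl = refl
next-previous {t = suc zero ∷ _}      refl = refl
next-previous {t = suc (suc zero) ∷ t} eq with next t in e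
next-previous {t = suc (suc zero) ∷ t} refl | just _ rewrite next-previous e = refl

next-injective : ∀ {m} {t t′ s : Vec (Fin 3) m} → next t ≡ just s → next t′ ≡ just s → t ≡ t′
next-injective e e′ = just-injective (trans (sym (next-previous e)) (next-previous e′))

next-base3 : ∀ {m} (t : Vec (Fin 3) m) {s} → next t ≡ just s → base3 s ≡ suc (base3 t)
next-base3 (zero ∷ _)           refl = refl
next-base3 (suc zero ∷ _)       refl = refl
next-base3 (suc (suc zero) ∷ t) eq with next t in e
next-base3 (suc (suc zero) ∷ t) refl | just _ rewrite next-base3 t e = *-suc 3 (base3 t)

next-nothing : ∀ {m} {t : Vec (Fin 3) m} → next t ≡ nothing → t ≡ replicate m (suc (suc zero))
next-nothing {t = []} _ = refl
next-nothing {t = suc (suc zero) ∷ t} eq with next t in e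
... | nothing = cong (suc (suc zero) ∷_) (next-nothing e)

↑ʳ≢↑ˡ : ∀ {m n} (i : Fin m) (j : Fin n) → m ↑ʳ j ≢ i ↑ˡ n
↑ʳ≢↑ˡ zero    _ ()
↑ʳ≢↑ˡ (suc i) j eq = ↑ʳ≢↑ˡ i j (suc-injective eq)

Cube : Set
Cube = Vec (Fin 3) 3

CubeLine : Set
CubeLine = Line (Fin 3) 2

-- Each line of the cube preys on a cube vertex or on one of six spill-over slots;
-- the spare vertices are the six cube vertices that are no line's prey.
preyTable : Vec (Vec (Vec (Cube ⊎ Fin 6) 3) 3) 3
preyTable =
    ( (inj₁ (# 1 ∷ # 0 ∷ # 2 ∷ []) ∷ inj₁ (# 2 ∷ # 2 ∷ # 1 ∷ []) ∷ inj₁ (# 0 ∷ # 1 ∷ # 0 ∷ []) ∷ [])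
    ∷ (inj₁ (# 0 ∷ # 1 ∷ # 2 ∷ []) ∷ inj₁ (# 0 ∷ # 0 ∷ # 1 ∷ []) ∷ inj₁ (# 1 ∷ # 2 ∷ # 0 ∷ []) ∷ [])
    ∷ (inj₁ (# 1 ∷ # 2 ∷ # 2 ∷ []) ∷ inj₁ (# 2 ∷ # 1 ∷ # 0 ∷ []) ∷ inj₂ (# 0)                   ∷ [])
    ∷ [])
  ∷ ( (inj₁ (# 0 ∷ # 2 ∷ # 2 ∷ []) ∷ inj₁ (# 2 ∷ # 0 ∷ # 1 ∷ []) ∷ inj₁ (# 1 ∷ # 1 ∷ # 2 ∷ []) ∷ [])
    ∷ (inj₂ (# 1)                   ∷ inj₁ (# 0 ∷ # 2 ∷ # 1 ∷ []) ∷ inj₂ (# 2)                   ∷ [])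
    ∷ (inj₁ (# 2 ∷ # 0 ∷ # 2 ∷ []) ∷ inj₁ (# 2 ∷ # 2 ∷ # 0 ∷ []) ∷ inj₁ (# 1 ∷ # 0 ∷ # 0 ∷ []) ∷ [])
    ∷ [])
  ∷ ( (inj₁ (# 1 ∷ # 1 ∷ # 0 ∷ []) ∷ inj₁ (# 0 ∷ # 2 ∷ # 0 ∷ []) ∷ inj₂ (# 3)                   ∷ [])
    ∷ (inj₁ (# 0 ∷ # 0 ∷ # 2 ∷ []) ∷ inj₂ (# 4)                   ∷ inj₂ (# 5)                   ∷ [])
    ∷ (inj₁ (# 2 ∷ # 1 ∷ # 2 ∷ []) ∷ inj₁ (# 0 ∷ # 0 ∷ # 0 ∷ []) ∷ inj₁ (# 2 ∷ # 0 ∷ # 0 ∷ []) ∷ [])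
    ∷ [])
  ∷ []

cubePrey : CubeLine → Cube ⊎ Fin 6
cubePrey (i , x ∷ y ∷ []) = lookup (lookup (lookup preyTable i) x) y

spareTable : Vec Cube 6
spareTable =
    (# 1 ∷ # 0 ∷ # 1 ∷ []) ∷ (# 0 ∷ # 1 ∷ # 1 ∷ []) ∷ (# 1 ∷ # 1 ∷ # 1 ∷ [])
  ∷ (# 2 ∷ # 1 ∷ # 1 ∷ []) ∷ (# 1 ∷ # 2 ∷ # 1 ∷ []) ∷ (# 2 ∷ # 2 ∷ # 2 ∷ []) ∷ []

spare : Fin 6 → Cube
spare = lookup spareTable

rankTable : Vec (Vec (Vec ℕ 3) 3) 3
rankTable =
    ((16 ∷ 7 ∷ 18 ∷ []) ∷ (20 ∷ 1 ∷ 21 ∷ []) ∷ (22 ∷ 6 ∷ 23 ∷ []) ∷ [])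
  ∷ ((15 ∷ 2 ∷ 17 ∷ []) ∷ (19 ∷ 4 ∷ 24 ∷ []) ∷ (25 ∷ 3 ∷ 26 ∷ []) ∷ [])
  ∷ ((12 ∷ 8 ∷ 13 ∷ []) ∷ (10 ∷ 0 ∷ 14 ∷ []) ∷ (11 ∷ 9 ∷  5 ∷ []) ∷ [])
  ∷ []

cubeRank : Cube → ℕ
cubeRank (a ∷ b ∷ c ∷ []) = lookup (lookup (lookup rankTable a) b) c

RankBelowPrey : ℕ → Cube ⊎ Fin 6 → Set
RankBelowPrey r (inj₁ v) = r < cubeRank v
RankBelowPrey r (inj₂ _) = ⊤

rankBelowPrey? : ∀ r p → Dec (RankBelowPrey r p)
rankBelowPrey? r (inj₁ v) = r <? cubeRank v
rankBelowPrey? r (inj₂ _) = yes _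

_≟ᶜ_ : DecidableEquality Cube
_≟ᶜ_ = ≡-decᵛ _≟ᶠ_

_≟ᶜᴸ_ : DecidableEquality CubeLine
_≟ᶜᴸ_ = ≡-decᵖ _≟ᶠ_ (≡-decᵛ _≟ᶠ_)

_≟ᵖ_ : DecidableEquality (Cube ⊎ Fin 6)
_≟ᵖ_ = ≡-decˢ _≟ᶜ_ _≟ᶠ_

-- Opaque, so that later proofs never unfold these facts back into the exhaustive checks.
opaque
  cubePrey-injective : ∀ ℓ ℓ′ → cubePrey ℓ ≡ cubePrey ℓ′ → ℓ ≡ ℓ′
  cubePrey-injective = from-yes (∀-line? λ ℓ → ∀-line? λ ℓ′ →
    (cubePrey ℓ ≟ᵖ cubePrey ℓ′) →-dec (ℓ ≟ᶜᴸ ℓ′))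

  cubePrey≢spare : ∀ ℓ j → cubePrey ℓ ≢ inj₁ (spare j)
  cubePrey≢spare = from-yes (∀-line? λ ℓ → all? λ j → ¬? (cubePrey ℓ ≟ᵖ inj₁ (spare j)))

  spare-injective : ∀ j j′ → spare j ≡ spare j′ → j ≡ j′
  spare-injective = from-yes (all? λ j → all? λ j′ → (spare j ≟ᶜ spare j′) →-dec (j ≟ᶠ j′))

  cubeRank<27 : ∀ v → cubeRank v < 27
  cubeRank<27 = from-yes (∀-vec? λ v → cubeRank v <? 27)

  cubeRank<prey : ∀ u ℓ → u ∈ᴸ ℓ → RankBelowPrey (cubeRank u) (cubePrey ℓ)
  cubeRank<prey = from-yes (∀-vec? λ u → ∀-line? λ ℓ →
    ≡-decᵛ _≟ᶠ_ (removeAt u (proj₁ ℓ)) (proj₂ ℓ) →-dec rankBelowPrey? (cubeRank u) (cubePrey ℓ))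

module Hamming3Representation (m : ℕ) where

  Tail : Set
  Tail = Vec (Fin 3) m

  Vertex : Set
  Vertex = Vec (Fin 3) (3 + m)

  HLine : Set
  HLine = Line (Fin 3) (2 + m)

  K : ℕ
  K = m * 3 ^ (2 + m)

  W : Set
  W = Vertex ⊎ Fin (K + 6)

  _⊕_ : Cube → Tail → Vertex
  v ⊕ t = v ++ t

  ⊕-injective : ∀ v v′ {t t′} → v ⊕ t ≡ v′ ⊕ t′ → v ≡ v′ × t ≡ t′
  ⊕-injective v v′ = ++-injective v v′

  extend : CubeLine → Tail → HLine
  extend (i , w) t = i ↑ˡ m , w ++ t

  data LineView : HLine → Set where
    inner : ∀ ℓ t → LineView (extend ℓ t)
    outer : ∀ d w → LineView (3 ↑ʳ d , w)

  lineView : ∀ ℓ → LineView ℓ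
  lineView (zero                , x ∷ y ∷ t) = inner (zero , x ∷ y ∷ []) t
  lineView (suc zero            , x ∷ y ∷ t) = inner (suc zero , x ∷ y ∷ []) t
  lineView (suc (suc zero)      , x ∷ y ∷ t) = inner (suc (suc zero) , x ∷ y ∷ []) t
  lineView (suc (suc (suc d))   , w)         = outer d w

  ∈-extend : ∀ u ℓ t → u ∈ᴸ extend ℓ t → ∃[ v ] (u ≡ v ⊕ t × v ∈ᴸ ℓ)
  ∈-extend (a ∷ _ ∷ _ ∷ _) (zero           , x ∷ y ∷ []) _ refl = a ∷ x ∷ y ∷ [] , refl , refl
  ∈-extend (_ ∷ b ∷ _ ∷ _) (suc zero       , x ∷ y ∷ []) _ refl = x ∷ b ∷ y ∷ [] , refl , refl
  ∈-extend (_ ∷ _ ∷ c ∷ _) (suc (suc zero) , x ∷ y ∷ []) _ refl = x ∷ y ∷ c ∷ [] , refl , refl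

  rank : Vertex → ℕ
  rank (a ∷ b ∷ c ∷ t) = cubeRank (a ∷ b ∷ c ∷ []) + 27 * base3 t

  rank-⊕ : ∀ v t → rank (v ⊕ t) ≡ cubeRank v + 27 * base3 t
  rank-⊕ (_ ∷ _ ∷ _ ∷ []) _ = refl

  spill : Fin 6 → Maybe Tail → W
  spill j (just s) = inj₁ (spare j ⊕ s)
  spill j nothing  = inj₂ (K ↑ʳ j)

  innerPrey : Cube ⊎ Fin 6 → Tail → W
  innerPrey (inj₁ v) t = inj₁ (v ⊕ t)
  innerPrey (inj₂ j) t = spill j (next t)

  preyᵛ : ∀ {ℓ} → LineView ℓ → W
  preyᵛ (inner ℓ t) = innerPrey (cubePrey ℓ) t
  preyᵛ (outer d w) = inj₂ (combine d (encode w) ↑ˡ 6)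

  prey : HLine → W
  prey ℓ = preyᵛ (lineView ℓ)

  spill-vertex : ∀ v {t} j s → inj₁ (v ⊕ t) ≡ spill j s → v ≡ spare j
  spill-vertex v j (just _) eq = proj₁ (⊕-injective v (spare j) (inj₁-injective eq))
  spill-vertex v j nothing  ()

  spill-injective : ∀ j j′ t t′ → spill j (next t) ≡ spill j′ (next t′) → j ≡ j′ × t ≡ t′
  spill-injective j j′ t t′ eq with next t in e | next t′ in e′
  ... | just _  | just _  with ⊕-injective (spare j) (spare j′) (inj₁-injective eq)
  ...   | same-spare , refl = spare-injective j j′ same-spare , next-injective e e′
  spill-injective j j′ t t′ eq | nothing | nothing =
    ↑ʳ-injective K j j′ (inj₂-injective eq) , trans (next-nothing e) (sym (next-nothing e′))
  spill-injective j j′ t t′ () | just _  | nothing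
  spill-injective j j′ t t′ () | nothing | just _

  innerPrey-injective : ∀ ℓ ℓ′ t t′ →
    innerPrey (cubePrey ℓ) t ≡ innerPrey (cubePrey ℓ′) t′ → ℓ ≡ ℓ′ × t ≡ t′
  innerPrey-injective ℓ ℓ′ t t′ eq with cubePrey ℓ in e | cubePrey ℓ′ in e′
  ... | inj₁ v | inj₁ v′ with ⊕-injective v v′ (inj₁-injective eq)
  ...   | refl , same-tail = cubePrey-injective ℓ ℓ′ (trans e (sym e′)) , same-tail
  innerPrey-injective ℓ ℓ′ t t′ eq | inj₁ v | inj₂ j′ =
    ⊥-elim (cubePrey≢spare ℓ j′ (trans e (cong inj₁ (spill-vertex v j′ (next t′) eq))))
  innerPrey-injective ℓ ℓ′ t t′ eq | inj₂ j | inj₁ v′ =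
    ⊥-elim (cubePrey≢spare ℓ′ j (trans e′ (cong inj₁ (spill-vertex v′ j (next t) (sym eq)))))
  innerPrey-injective ℓ ℓ′ t t′ eq | inj₂ j | inj₂ j′ with spill-injective j j′ t t′ eq
  ... | refl , same-tail = cubePrey-injective ℓ ℓ′ (trans e (sym e′)) , same-tail

  innerPrey≢outer : ∀ ℓ t i → innerPrey (cubePrey ℓ) t ≢ inj₂ (i ↑ˡ 6)
  innerPrey≢outer ℓ t i eq with cubePrey ℓ
  ... | inj₂ j with next t
  ...   | nothing = ↑ʳ≢↑ˡ i j (inj₂-injective eq)

  preyᵛ-injective : ∀ {ℓ ℓ′} (p : LineView ℓ) (p′ : LineView ℓ′) →
    preyᵛ p ≡ preyᵛ p′ → ℓ ≡ ℓ′
  preyᵛ-injective (inner ℓ t) (inner ℓ′ t′) eq with innerPrey-injective ℓ ℓ′ t t′ eq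
  ... | refl , refl = refl
  preyᵛ-injective (inner ℓ t) (outer _ _) eq = ⊥-elim (innerPrey≢outer ℓ t _ eq)
  preyᵛ-injective (outer _ _) (inner ℓ′ t′) eq = ⊥-elim (innerPrey≢outer ℓ′ t′ _ (sym eq))
  preyᵛ-injective (outer d w) (outer d′ w′) eq
    with combine-injective d (encode w) d′ (encode w′) (↑ˡ-injective 6 _ _ (inj₂-injective eq))
  ... | refl , same-code = cong (3 ↑ʳ d ,_) (encode-injective same-code)

  prey-injective : Injective _≡_ _≡_ prey
  prey-injective {ℓ} {ℓ′} = preyᵛ-injective (lineView ℓ) (lineView ℓ′)

  innerPrey-rank : ∀ u ℓ t {v} → u ∈ᴸ ℓ → innerPrey (cubePrey ℓ) t ≡ inj₁ v →
    rank (u ⊕ t) < rank v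
  innerPrey-rank u ℓ t u∈ℓ eq with cubePrey ℓ | cubeRank<prey u ℓ u∈ℓ
  innerPrey-rank u ℓ t u∈ℓ refl | inj₁ v | u<v = begin-strict
    rank (u ⊕ t)                  ≡⟨ rank-⊕ u t ⟩
    cubeRank u + 27 * base3 t     <⟨ +-monoˡ-< (27 * base3 t) u<v ⟩
    cubeRank v + 27 * base3 t     ≡⟨ rank-⊕ v t ⟨
    rank (v ⊕ t)                  ∎
    where open ≤-Reasoning
  innerPrey-rank u ℓ t u∈ℓ eq | inj₂ j | _ with next t in e
  innerPrey-rank u ℓ t u∈ℓ refl | inj₂ j | _ | just s = begin-strict
    rank (u ⊕ t)                          ≡⟨ rank-⊕ u t ⟩
    cubeRank u + 27 * base3 t             <⟨ +-monoˡ-< (27 * base3 t) (cubeRank<27 u) ⟩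
    27 + 27 * base3 t                     ≡⟨ *-suc 27 (base3 t) ⟨
    27 * suc (base3 t)                    ≡⟨ cong (27 *_) (next-base3 t e) ⟨
    27 * base3 s                          ≤⟨ m≤n+m (27 * base3 s) (cubeRank (spare j)) ⟩
    cubeRank (spare j) + 27 * base3 s     ≡⟨ rank-⊕ (spare j) s ⟨
    rank (spare j ⊕ s)                    ∎
    where open ≤-Reasoning

  prey-rank : ∀ u ℓ {v} → u ∈ᴸ ℓ → prey ℓ ≡ inj₁ v → rank u < rank v
  prey-rank u ℓ u∈ℓ eq with lineView ℓ
  prey-rank u .(extend ℓ t) u∈ℓ eq | inner ℓ t with ∈-extend u ℓ t u∈ℓ
  ... | v , refl , v∈ℓ = innerPrey-rank v ℓ t v∈ℓ eq

  representable : CompetitionRepresentable (Hamming3 (3 + m)) (K + 6)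
  representable = CliqueCoverRepresentation.representable
    _∈ᴸ_ hamming3⇔collinear prey prey-injective rank prey-rank

corollary3p2 : (n : ℕ) → 3 ≤ n →
    CompetitionNumber≤ (Hamming3 n) ((n ∸ 3) * 3 ^ (n ∸ 1) + 6)
corollary3p2 (suc (suc (suc m))) _ = _ , ≤-refl , Hamming3Representation.representable m
corollary3p2 (suc zero)       (s≤s ())
corollary3p2 (suc (suc zero)) (s≤s (s≤s ()))
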